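{- Let $G\colon\mathsf{Nom}\to\mathsf{Nom}$ be $GX=2\times X^{\mathbb{A}}\times[\mathbb{A}]X$. The terminal $G$-coalgebra is the nominal set $\mathcal{P}_{\mathsf{fs}}(\bar{\mathbb{A}}^*/{=_\alpha})$ of all finitely supported bar languages with the structure $\tau(S)=(b,\,a\mapsto S_a,\,S_{|a})$, where $b=1$ if $[\varepsilon]_\alpha\in S$ and $b=0$ otherwise, $S_a=\{[w]_\alpha:[aw]_\alpha\in S\}$, and $S_{|a}=\langle a\rangle\{[w]_\alpha:[{|}a\,w]_\alpha\in S\}$ for any name $a$ fresh for $S$.
   Context: Fix a countably infinite set $\mathbb{A}$ of names; a nominal set is a set with an action of the finite permutations of $\mathbb{A}$ in which every element $x$ has a finite support with least support $\mathrm{supp}(x)$, and $a$ is fresh for $x$ if $a\notin\mathrm{supp}(x)$; $\mathsf{Nom}$ is the category of nominal sets and equivariant maps; $X^{\mathbb{A}}$ is the exponential (finitely supported functions); $2=\{0,1\}$. The abstraction set $[\mathbb{A}]X$ is the quotient of $\mathbb{A}\times X$ by $(a,x)\sim(b,y)$ iff $(a\,c)\cdot x=(b\,c)\cdot y$ for some (equivalently all) $c$ fresh for $a,b,x,y$; classes written $\langle a\rangle x$. Bar strings are finite words over $\bar{\mathbb{A}}=\mathbb{A}\cup\{{|}a:a\in\mathbb{A}\}$; $=_\alpha$ is the least equivalence relation on $\bar{\mathbb{A}}^*$ with $x\,{|}a\,v=_\alpha x\,{|}b\,w$ whenever $\langle a\rangle v=\langle b\rangle w$ in $[\mathbb{A}]\bar{\mathbb{A}}^*$;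 $[w]_\alpha$ is the class of $w$, and $\bar{\mathbb{A}}^*/{=_\alpha}$ is a nominal set with $\pi\cdot[w]_\alpha=[\pi\cdot w]_\alpha$. $\mathcal{P}_{\mathsf{fs}}Y$ is the nominal set of finitely supported subsets of $Y$. -}

module Defs where

open import Data.Nat using (ℕ)
open import Data.Nat.Properties using (_≟_)
open import Data.Bool using (Bool)
open import Data.List using (List; []; _∷_; _++_; reverse; map; [_])
open import Data.List.Properties using (map-++; reverse-++; reverse-involutive; unfold-reverse; ++-assoc)
open import Data.List.Membership.Propositional using (_∈_; _∉_)
open import Data.List.Membership.Propositional.Properties using (∈-map⁺; ∈-map⁻)
open import Data.Product using (Σ; ∃; _×_; _,_; proj₁; proj₂)
open import Data.Empty using (⊥-elim)
open import Relation.Binary.PropositionalEquality hiding ([_])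
open import Relation.Binary.Structures using (IsEquivalence)
open import Relation.Nullary using (¬_; yes; no)

𝔸 : Set
𝔸 = ℕ

swap : 𝔸 → 𝔸 → 𝔸 → 𝔸
swap a b c with c ≟ a | c ≟ b
... | yes _ | _     = b
... | no _  | yes _ = a
... | no _  | no _  = c

-- A finite permutation, presented as a finite composite of transpositions:
-- (a₁ , b₁) ∷ (a₂ , b₂) ∷ … denotes (a₁ b₁) ∘ (a₂ b₂) ∘ …
-- Every finite permutation of 𝔸 arises this way; two presentations denote
-- the same permutation iff 'apply' agrees on all names.
Perm : Set
Perm = List (𝔸 × 𝔸)

apply : Perm → 𝔸 → 𝔸
apply []             c = c
apply ((a , b) ∷ π)  c = swap a b (apply π c)

inv : Perm → Perm
inv = reverse

Fixes : Perm → List 𝔸 → Set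
Fixes π A = ∀ a → a ∈ A → apply π a ≡ a

record RawNom : Set₁ where
  field
    Carrier : Set
    _≈_     : Carrier → Carrier → Set
    act     : Perm → Carrier → Carrier

open RawNom public

Supports : (X : RawNom) → List 𝔸 → Carrier X → Set
Supports X A x = ∀ π → Fixes π A → _≈_ X (act X π x) x

-- a is fresh for x: a lies outside some finite support of x (equivalently,
-- for a nominal set, outside the least support supp(x)).
Fresh : (X : RawNom) → 𝔸 → Carrier X → Set
Fresh X a x = ∃ λ A → Supports X A x × a ∉ A

record IsNominal (X : RawNom) : Set where
  field
    ≈-equiv  : IsEquivalence (_≈_ X)
    act-cong : ∀ π {x y} → _≈_ X x y → _≈_ X (act X π x) (act X π y)
    act-id   : ∀ x → _≈_ X (act X [] x) x
    act-comp : ∀ π σ x → _≈_ X (act X (π ++ σ) x) (act X π (act X σ x))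
    act-ext  : ∀ π σ → (∀ a → apply π a ≡ apply σ a) → ∀ x → _≈_ X (act X π x) (act X σ x)
    fin-supp : ∀ x → ∃ λ A → Supports X A x

record Nom : Set₁ where
  field
    raw   : RawNom
    isNom : IsNominal raw

Equivariant : (X Y : RawNom) → (Carrier X → Carrier Y) → Set
Equivariant X Y f =
  (∀ {x y} → _≈_ X x y → _≈_ Y (f x) (f y)) ×
  (∀ π x → _≈_ Y (f (act X π x)) (act Y π (f x)))

AbsEq : (X : RawNom) → 𝔸 × Carrier X → 𝔸 × Carrier X → Set
AbsEq X (a , x) (b , y) =
  ∃ λ c → ¬ c ≡ a × ¬ c ≡ b × Fresh X c x × Fresh X c y ×
          _≈_ X (act X [ (a , c) ] x) (act X [ (b , c) ] y)

record GCar (X : RawNom) : Set where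
  constructor ⟨_,_,_⟩
  field
    out : Bool
    tr  : 𝔸 → Carrier X
    ab  : 𝔸 × Carrier X             -- representative ⟨a⟩x of [𝔸]X

open GCar public

G : RawNom → RawNom
G X = record
  { Carrier = GCar X
  ; _≈_ = λ u v → (out u ≡ out v) × (∀ a → _≈_ X (tr u a) (tr v a)) × AbsEq X (ab u) (ab v)
  ; act = λ π u → ⟨ out u , (λ a → act X π (tr u (apply (inv π) a))) ,
                    (apply π (proj₁ (ab u)) , act X π (proj₂ (ab u))) ⟩
  }

Gmap : (X Y : RawNom) → (Carrier X → Carrier Y) → GCar X → GCar Y
Gmap X Y h u = ⟨ out u , (λ a → h (tr u a)) , (proj₁ (ab u) , h (proj₂ (ab u))) ⟩

data BarLetter : Set where
  nm  : 𝔸 → BarLetter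
  bar : 𝔸 → BarLetter

BarString : Set
BarString = List BarLetter

actB : Perm → BarLetter → BarLetter
actB π (nm a)  = nm (apply π a)
actB π (bar a) = bar (apply π a)

actW : Perm → BarString → BarString
actW π = map (actB π)

nameB : BarLetter → 𝔸
nameB (nm a)  = a
nameB (bar a) = a

names : BarString → List 𝔸
names = map nameB

data _=α_ : BarString → BarString → Set where
  α-refl  : ∀ {w} → w =α w
  α-sym   : ∀ {v w} → v =α w → w =α v
  α-trans : ∀ {u v w} → u =α v → v =α w → u =α w
  α-abs   : ∀ x a b v w c → ¬ c ≡ a → ¬ c ≡ b → c ∉ names v → c ∉ names w →
            actW [ (a , c) ] v ≡ actW [ (b , c) ] w →
            (x ++ bar a ∷ v) =α (x ++ bar b ∷ w)

apply-++ : ∀ π σ c → apply (π ++ σ) c ≡ apply π (apply σ c)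
apply-++ []            σ c = refl
apply-++ ((a , b) ∷ π) σ c = cong (swap a b) (apply-++ π σ c)

swap-invol : ∀ a b c → swap a b (swap a b c) ≡ c
swap-invol a b c with c ≟ a | c ≟ b
... | yes c≡a | _ with b ≟ a | b ≟ b
...   | yes b≡a | _ = trans b≡a (sym c≡a)
...   | no _ | yes _ = sym c≡a
...   | no _ | no b≢b = ⊥-elim (b≢b refl)
swap-invol a b c | no c≢a | yes c≡b with a ≟ a
...   | yes _ = sym c≡b
...   | no a≢a = ⊥-elim (a≢a refl)
swap-invol a b c | no c≢a | no c≢b with c ≟ a | c ≟ b
...   | yes c≡a | _ = ⊥-elim (c≢a c≡a)
...   | no _ | yes c≡b = ⊥-elim (c≢b c≡b)
...   | no _ | no _ = refl

inv-apply : ∀ π c → apply (inv π) (apply π c) ≡ c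
inv-apply [] c = refl
inv-apply ((a , b) ∷ π) c =
  begin
    apply (reverse ((a , b) ∷ π)) (swap a b (apply π c))
  ≡⟨ cong (λ p → apply p (swap a b (apply π c))) (unfold-reverse (a , b) π) ⟩
    apply (reverse π ++ [ (a , b) ]) (swap a b (apply π c))
  ≡⟨ apply-++ (reverse π) [ (a , b) ] _ ⟩
    apply (reverse π) (swap a b (swap a b (apply π c)))
  ≡⟨ cong (apply (reverse π)) (swap-invol a b (apply π c)) ⟩
    apply (reverse π) (apply π c)
  ≡⟨ inv-apply π c ⟩
    c
  ∎
  where open ≡-Reasoning

apply-inv : ∀ π c → apply π (apply (inv π) c) ≡ c
apply-inv π c =
  trans (cong (λ p → apply p (apply (inv π) c)) (sym (reverse-involutive π)))
        (inv-apply (inv π) c)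

apply-inj : ∀ π {c d} → apply π c ≡ apply π d → c ≡ d
apply-inj π {c} {d} e =
  trans (sym (inv-apply π c)) (trans (cong (apply (inv π)) e) (inv-apply π d))

swap-conj : (f : 𝔸 → 𝔸) → (∀ {c d} → f c ≡ f d → c ≡ d) →
            ∀ a b d → swap (f a) (f b) (f d) ≡ f (swap a b d)
swap-conj f inj a b d with d ≟ a | d ≟ b | f d ≟ f a | f d ≟ f b
... | yes _   | _       | yes _ | _     = refl
... | yes d≡a | _       | no ne | _     = ⊥-elim (ne (cong f d≡a))
... | no d≢a  | _       | yes e | _     = ⊥-elim (d≢a (inj e))
... | no _    | yes _   | no _  | yes _ = refl
... | no _    | yes d≡b | no _  | no ne = ⊥-elim (ne (cong f d≡b))
... | no _    | no d≢b  | no _  | yes e = ⊥-elim (d≢b (inj e))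
... | no _    | no _    | no _  | no _  = refl

actB-pt : ∀ π σ ρ → (∀ d → apply π (apply σ d) ≡ apply ρ d) →
          ∀ l → actB π (actB σ l) ≡ actB ρ l
actB-pt π σ ρ h (nm a)  = cong nm (h a)
actB-pt π σ ρ h (bar a) = cong bar (h a)

actW-pt : ∀ π σ ρ → (∀ d → apply π (apply σ d) ≡ apply ρ d) →
          ∀ w → actW π (actW σ w) ≡ actW ρ w
actW-pt π σ ρ h []      = refl
actW-pt π σ ρ h (l ∷ w) = cong₂ _∷_ (actB-pt π σ ρ h l) (actW-pt π σ ρ h w)

names-actW : ∀ π w → names (actW π w) ≡ map (apply π) (names w)
names-actW π []            = refl
names-actW π (nm a ∷ w)    = cong (apply π a ∷_) (names-actW π w)
names-actW π (bar a ∷ w)   = cong (apply π a ∷_) (names-actW π w)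

fresh-actW : ∀ π c w → c ∉ names w → apply π c ∉ names (actW π w)
fresh-actW π c w c∉ p with ∈-map⁻ (apply π) (subst (apply π c ∈_) (names-actW π w) p)
... | d , d∈ , e = c∉ (subst (_∈ names w) (sym (apply-inj π e)) d∈)

α-equiv : ∀ π {v w} → v =α w → actW π v =α actW π w
α-equiv π α-refl = α-refl
α-equiv π (α-sym p) = α-sym (α-equiv π p)
α-equiv π (α-trans p q) = α-trans (α-equiv π p) (α-equiv π q)
α-equiv π (α-abs x a b v w c c≢a c≢b cv cw e) =
  subst₂ _=α_ (sym (map-++ (actB π) x (bar a ∷ v))) (sym (map-++ (actB π) x (bar b ∷ w)))
    (α-abs (actW π x) (apply π a) (apply π b) (actW π v) (actW π w) (apply π c)
      (λ q → c≢a (apply-inj π q)) (λ q → c≢b (apply-inj π q))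
      (fresh-actW π c v cv) (fresh-actW π c w cw)
      (begin
         actW [ (apply π a , apply π c) ] (actW π v)
       ≡⟨ actW-pt [ (apply π a , apply π c) ] π (π ++ [ (a , c) ])
            (λ d → trans (swap-conj (apply π) (apply-inj π) a c d)
                         (sym (apply-++ π [ (a , c) ] d))) v ⟩
         actW (π ++ [ (a , c) ]) v
       ≡⟨ sym (actW-pt π [ (a , c) ] (π ++ [ (a , c) ]) (λ d → sym (apply-++ π _ d)) v) ⟩
         actW π (actW [ (a , c) ] v)
       ≡⟨ cong (actW π) e ⟩
         actW π (actW [ (b , c) ] w)
       ≡⟨ actW-pt π [ (b , c) ] (π ++ [ (b , c) ]) (λ d → sym (apply-++ π _ d)) w ⟩
         actW (π ++ [ (b , c) ]) w
       ≡⟨ sym (actW-pt [ (apply π b , apply π c) ] π (π ++ [ (b , c) ])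
            (λ d → trans (swap-conj (apply π) (apply-inj π) b c d)
                         (sym (apply-++ π [ (b , c) ] d))) w) ⟩
         actW [ (apply π b , apply π c) ] (actW π w)
       ∎))
  where open ≡-Reasoning

-- A subset of 𝔸̄*/=α is given by its characteristic function on
-- representatives, which must respect =α.
RespectsAlpha : (BarString → Bool) → Set
RespectsAlpha S = ∀ v w → v =α w → S v ≡ S w

-- A supports S, for the action (π·S)(w) = S(π⁻¹·w).
SuppLang : List 𝔸 → (BarString → Bool) → Set
SuppLang A S = ∀ π → Fixes π A → ∀ w → S (actW (inv π) w) ≡ S w

BarLang : Set
BarLang = Σ (BarString → Bool) λ S → RespectsAlpha S × ∃ λ A → SuppLang A S

_∋_ : BarLang → BarString → Bool
S ∋ w = proj₁ S w

private
  inv-++ : ∀ π σ d → apply (inv (π ++ σ)) d ≡ apply (inv σ) (apply (inv π) d)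
  inv-++ π σ d = trans (cong (λ p → apply p d) (reverse-++ π σ)) (apply-++ (inv σ) (inv π) d)

actLang : Perm → BarLang → BarLang
actLang π (S , r , A , s) =
  (λ w → S (actW (inv π) w)) ,
  (λ v w p → r _ _ (α-equiv (inv π) p)) ,
  map (apply π) A ,
  λ σ fx w →
    let ρ = inv π ++ (σ ++ π) in
    let fixρ : Fixes ρ A
        fixρ a a∈ = trans (apply-++ (inv π) (σ ++ π) a)
                   (trans (cong (apply (inv π)) (apply-++ σ π a))
                   (trans (cong (apply (inv π)) (fx (apply π a) (∈-map⁺ (apply π) a∈)))
                          (inv-apply π a))) in
    trans (cong S (trans (actW-pt (inv π) (inv σ) (inv ρ ++ inv π)
                           (λ d → sym (lem σ d)) w)
                         (sym (actW-pt (inv ρ) (inv π) (inv ρ ++ inv π)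
                           (λ d → sym (apply-++ (inv ρ) (inv π) d)) w))))
          (s ρ fixρ (actW (inv π) w))
  where
  lem : ∀ σ d → apply (inv (inv π ++ (σ ++ π)) ++ inv π) d ≡ apply (inv π) (apply (inv σ) d)
  lem σ d =
    trans (apply-++ (inv (inv π ++ (σ ++ π))) (inv π) d)
   (trans (inv-++ (inv π) (σ ++ π) (apply (inv π) d))
   (trans (inv-++ σ π (apply (inv (inv π)) (apply (inv π) d)))
          (cong (λ z → apply (inv π) (apply (inv σ) z))
            (trans (cong (λ p → apply p (apply (inv π) d)) (reverse-involutive π))
                   (apply-inv π d)))))

Lang : RawNom
Lang = record
  { Carrier = BarLang
  ; _≈_ = λ S T → ∀ w → (S ∋ w) ≡ (T ∋ w)
  ; act = actLang
  }

IsCoalgHom : (X : RawNom) → (Carrier X → GCar X) → (BarLang → GCar Lang) →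
             (Carrier X → BarLang) → Set
IsCoalgHom X c τ h =
  Equivariant X Lang h ×
  (∀ x → _≈_ (G Lang) (τ (h x)) (Gmap X Lang h (c x)))

IsTau : (BarLang → GCar Lang) → Set
IsTau τ = ∀ S →
  (out (τ S) ≡ (S ∋ [])) ×
  (∀ a w → (tr (τ S) a ∋ w) ≡ (S ∋ (nm a ∷ w))) ×
  (∀ a → Fresh Lang a S → ∀ (T : BarLang) → (∀ w → (T ∋ w) ≡ (S ∋ (bar a ∷ w))) →
     AbsEq Lang (ab (τ S)) (a , T))

{-# OPTIONS --safe #-}
module Submission where

open import Defs
open import Data.Bool using (Bool; false)
open import Data.Empty using (⊥-elim)
open import Data.List using (List; []; _∷_; _++_; map; length; [_])
open import Data.List.Properties using (length-map; reverse-++)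
open import Data.List.Membership.Propositional using (_∈_; _∉_)
open import Data.List.Membership.Propositional.Properties using (∈-map⁺; ∈-map⁻; ∈-++⁺ˡ; ∈-++⁺ʳ)
open import Data.List.Relation.Unary.Any using (here; there)
open import Data.Nat using (ℕ; zero; suc; _≤_)
open import Data.Nat.ListAction using (sum)
open import Data.Nat.Properties using (_≟_; m≤m+n; m≤n+m; ≤-trans; <-irrefl; suc-injective)
open import Data.Product using (Σ; _×_; _,_; proj₁; proj₂)
open import Relation.Binary.PropositionalEquality hiding ([_])
open import Relation.Binary.Structures using (IsEquivalence)
open import Relation.Nullary using (yes; no; Dec)

-- A G-coalgebra (X , c) is unfolded into a bar language: x accepts ε iff its
-- output bit is 1, accepts a w iff its a-successor accepts w, and accepts |a w
-- iff (b d)·y accepts (a d)·w, where ⟨b⟩y is the abstraction component of x and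
-- d is a name fresh for everything in sight.  By a simultaneous induction on the
-- length of words, the choice of d is irrelevant and acceptance is equivariant.
-- Hence the accepted language is α-invariant and supported by every support of
-- x, and unfolding is a coalgebra morphism into τ.  Conversely, any morphism into
-- τ satisfies the same three clauses, which determine it by induction on length.

swap-fst : ∀ a b → swap a b a ≡ b
swap-fst a b with a ≟ a
... | yes _   = refl
... | no a≢a  = ⊥-elim (a≢a refl)

swap-snd : ∀ a b → swap a b b ≡ a
swap-snd a b with b ≟ a | b ≟ b
... | yes b≡a | _       = b≡a
... | no _    | yes _   = refl
... | no _    | no b≢b  = ⊥-elim (b≢b refl)

swap-fresh : ∀ {a b z} → z ≢ a → z ≢ b → swap a b z ≡ z
swap-fresh {a} {b} {z} z≢a z≢b with z ≟ a | z ≟ b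
... | yes z≡a | _       = ⊥-elim (z≢a z≡a)
... | no _    | yes z≡b = ⊥-elim (z≢b z≡b)
... | no _    | no _    = refl

swap-triangle : ∀ {a c d} → a ≢ c → a ≢ d → c ≢ d →
                ∀ z → swap c d (swap a c z) ≡ swap a d (swap c d z)
swap-triangle {a} {c} {d} a≢c a≢d c≢d z = by-cases (z ≟ a) (z ≟ c) (z ≟ d)
  where
  by-cases : ∀ {z} → Dec (z ≡ a) → Dec (z ≡ c) → Dec (z ≡ d) →
             swap c d (swap a c z) ≡ swap a d (swap c d z)
  by-cases (yes refl) _ _ =
    trans (trans (cong (swap c d) (swap-fst a c)) (swap-fst c d))
          (sym (trans (cong (swap a d) (swap-fresh a≢c a≢d)) (swap-fst a d)))
  by-cases (no z≢a) (yes refl) _ =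
    trans (trans (cong (swap c d) (swap-snd a c)) (swap-fresh a≢c a≢d))
          (sym (trans (cong (swap a d) (swap-fst c d)) (swap-snd a d)))
  by-cases (no z≢a) (no z≢c) (yes refl) =
    trans (trans (cong (swap c d) (swap-fresh z≢a z≢c)) (swap-snd c d))
          (sym (trans (cong (swap a d) (swap-snd c d)) (swap-fresh (λ c≡a → a≢c (sym c≡a)) c≢d)))
  by-cases (no z≢a) (no z≢c) (no z≢d) =
    trans (trans (cong (swap c d) (swap-fresh z≢a z≢c)) (swap-fresh z≢c z≢d))
          (sym (trans (cong (swap a d) (swap-fresh z≢c z≢d)) (swap-fresh z≢a z≢d)))

fresh : List 𝔸 → 𝔸
fresh L = suc (sum L)

fresh-∉ : ∀ L → fresh L ∉ L
fresh-∉ L p = <-irrefl refl (∈⇒≤sum L p)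
  where
  ∈⇒≤sum : ∀ {x} L → x ∈ L → x ≤ sum L
  ∈⇒≤sum (y ∷ L) (here refl) = m≤m+n y (sum L)
  ∈⇒≤sum (y ∷ L) (there p)   = ≤-trans (∈⇒≤sum L p) (m≤n+m (sum L) y)

∉-head : ∀ {c a : 𝔸} {L} → c ∉ a ∷ L → c ≢ a
∉-head c∉ c≡a = c∉ (here c≡a)

∉-tail : ∀ {c a : 𝔸} {L} → c ∉ a ∷ L → c ∉ L
∉-tail c∉ c∈ = c∉ (there c∈)

∉-++ˡ : ∀ {c : 𝔸} A {B} → c ∉ A ++ B → c ∉ A
∉-++ˡ A c∉ c∈ = c∉ (∈-++⁺ˡ c∈)

∉-++ʳ : ∀ {c : 𝔸} A {B} → c ∉ A ++ B → c ∉ B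
∉-++ʳ A c∉ c∈ = c∉ (∈-++⁺ʳ A c∈)

swap-fixes : ∀ {a c} A → a ∉ A → c ∉ A → Fixes [ (a , c) ] A
swap-fixes A a∉A c∉A z z∈A =
  swap-fresh (λ z≡a → a∉A (subst (_∈ A) z≡a z∈A)) (λ z≡c → c∉A (subst (_∈ A) z≡c z∈A))

inv-++ : ∀ π σ d → apply (inv (π ++ σ)) d ≡ apply (inv σ) (apply (inv π) d)
inv-++ π σ d = trans (cong (λ ρ → apply ρ d) (reverse-++ π σ)) (apply-++ (inv σ) (inv π) d)

inv-pointwise : ∀ π σ → (∀ a → apply π a ≡ apply σ a) → ∀ a → apply (inv π) a ≡ apply (inv σ) a
inv-pointwise π σ π≗σ a =
  apply-inj σ (trans (sym (π≗σ _)) (trans (apply-inv π a) (sym (apply-inv σ a))))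

fixes-inv : ∀ π A → Fixes π A → Fixes (inv π) A
fixes-inv π A fix a a∈A = trans (cong (apply (inv π)) (sym (fix a a∈A))) (inv-apply π a)

apply-∉-map : ∀ π {a} A → a ∉ A → apply π a ∉ map (apply π) A
apply-∉-map π A a∉A πa∈ with ∈-map⁻ (apply π) πa∈
... | d , d∈A , πa≡πd = a∉A (subst (_∈ A) (sym (apply-inj π πa≡πd)) d∈A)

∉-map-inv⇒apply-∉ : ∀ π {d} A → d ∉ map (apply (inv π)) A → apply π d ∉ A
∉-map-inv⇒apply-∉ π {d} A d∉ πd∈A =
  d∉ (subst (_∈ map (apply (inv π)) A) (inv-apply π d) (∈-map⁺ (apply (inv π)) πd∈A))

actW-fixes : ∀ π w → Fixes π (names w) → actW π w ≡ w
actW-fixes π []          fix = refl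
actW-fixes π (nm a ∷ w)  fix =
  cong₂ _∷_ (cong nm (fix a (here refl))) (actW-fixes π w (λ z z∈ → fix z (there z∈)))
actW-fixes π (bar a ∷ w) fix =
  cong₂ _∷_ (cong bar (fix a (here refl))) (actW-fixes π w (λ z z∈ → fix z (there z∈)))

actW-id : ∀ w → actW [] w ≡ w
actW-id w = actW-fixes [] w (λ _ _ → refl)

actW-pointwise : ∀ π σ → (∀ a → apply π a ≡ apply σ a) → ∀ w → actW π w ≡ actW σ w
actW-pointwise π σ π≗σ w = trans (sym (actW-id (actW π w))) (actW-pt [] π σ π≗σ w)

actW-∷ : ∀ p σ w → actW [ p ] (actW σ w) ≡ actW (p ∷ σ) w
actW-∷ p σ = actW-pt [ p ] σ (p ∷ σ) (λ _ → refl)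

actW-swap-fresh : ∀ {a c} w → a ∉ names w → c ∉ names w → actW [ (a , c) ] w ≡ w
actW-swap-fresh w a∉ c∉ = actW-fixes _ w (swap-fixes (names w) a∉ c∉)

length-actW : ∀ π w → length (actW π w) ≡ length w
length-actW π = length-map (actB π)

actW-swap-invol : ∀ a c w → actW [ (a , c) ] (actW [ (a , c) ] w) ≡ w
actW-swap-invol a c w = trans (actW-pt [ (a , c) ] [ (a , c) ] [] (swap-invol a c) w) (actW-id w)

actW-inv : ∀ π w → actW π (actW (inv π) w) ≡ w
actW-inv π w = trans (actW-pt π (inv π) [] (apply-inv π) w) (actW-id w)

actW-swap-triangle : ∀ {a c d} w → a ≢ c → a ≢ d → c ≢ d → c ∉ names w → d ∉ names w →
                     actW [ (c , d) ] (actW [ (a , c) ] w) ≡ actW [ (a , d) ] w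
actW-swap-triangle {a} {c} {d} w a≢c a≢d c≢d c∉ d∉ =
  begin
    actW [ (c , d) ] (actW [ (a , c) ] w)
  ≡⟨ actW-pt [ (c , d) ] [ (a , c) ] ((a , d) ∷ (c , d) ∷ []) (swap-triangle a≢c a≢d c≢d) w ⟩
    actW ((a , d) ∷ (c , d) ∷ []) w
  ≡⟨ sym (actW-∷ (a , d) [ (c , d) ] w) ⟩
    actW [ (a , d) ] (actW [ (c , d) ] w)
  ≡⟨ cong (actW [ (a , d) ]) (actW-swap-fresh w c∉ d∉) ⟩
    actW [ (a , d) ] w
  ∎
  where open ≡-Reasoning

actW-swap-conj : ∀ π a d w → actW [ (apply π a , apply π d) ] (actW π w) ≡ actW π (actW [ (a , d) ] w)
actW-swap-conj π a d w =
  trans (actW-pt [ (apply π a , apply π d) ] π (π ++ [ (a , d) ])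
          (λ z → trans (swap-conj (apply π) (apply-inj π) a d z) (sym (apply-++ π [ (a , d) ] z))) w)
        (sym (actW-pt π [ (a , d) ] (π ++ [ (a , d) ]) (λ z → sym (apply-++ π [ (a , d) ] z)) w))

actW-abs-rename : ∀ {a b c d v w} → c ≢ a → c ≢ b → c ∉ names v → c ∉ names w →
                  d ≢ a → d ≢ b → d ≢ c → d ∉ names v → d ∉ names w →
                  actW [ (a , c) ] v ≡ actW [ (b , c) ] w → actW [ (a , d) ] v ≡ actW [ (b , d) ] w
actW-abs-rename {a} {b} {c} {d} {v} {w} c≢a c≢b c∉v c∉w d≢a d≢b d≢c d∉v d∉w ac·v≡bc·w =
  begin
    actW [ (a , d) ] v
  ≡⟨ sym (actW-swap-triangle v (≢-sym c≢a) (≢-sym d≢a) (≢-sym d≢c) c∉v d∉v) ⟩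
    actW [ (c , d) ] (actW [ (a , c) ] v)
  ≡⟨ cong (actW [ (c , d) ]) ac·v≡bc·w ⟩
    actW [ (c , d) ] (actW [ (b , c) ] w)
  ≡⟨ actW-swap-triangle w (≢-sym c≢b) (≢-sym d≢b) (≢-sym d≢c) c∉w d∉w ⟩
    actW [ (b , d) ] w
  ∎
  where open ≡-Reasoning

=α-cons : ∀ l {v w} → v =α w → (l ∷ v) =α (l ∷ w)
=α-cons l α-refl                       = α-refl
=α-cons l (α-sym p)                    = α-sym (=α-cons l p)
=α-cons l (α-trans p q)                = α-trans (=α-cons l p) (=α-cons l q)
=α-cons l (α-abs x a b v w c p q r s t) = α-abs (l ∷ x) a b v w c p q r s t

bar-rename-α : ∀ a d w → d ≢ a → d ∉ names w → (bar a ∷ w) =α (bar d ∷ actW [ (a , d) ] w)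
bar-rename-α a d w d≢a d∉w =
  α-abs [] a d w (actW [ (a , d) ] w) e e≢a e≢d e∉w e∉ad·w
        (sym (actW-swap-triangle w (≢-sym d≢a) (≢-sym e≢a) (≢-sym e≢d) d∉w e∉w))
  where
  L = a ∷ d ∷ names w ++ names (actW [ (a , d) ] w)
  e = fresh L
  e∉L = fresh-∉ L
  e≢a = ∉-head e∉L
  e≢d = ∉-head (∉-tail e∉L)
  e∉w = ∉-++ˡ (names w) (∉-tail (∉-tail e∉L))
  e∉ad·w = ∉-++ʳ (names w) (∉-tail (∉-tail e∉L))

module NominalSet (X : RawNom) (isNom : IsNominal X) where
  open IsNominal isNom
  module ≈ = IsEquivalence ≈-equiv

  ≡⇒≈ : ∀ {x y} → x ≡ y → _≈_ X x y
  ≡⇒≈ refl = ≈.refl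

  act-swap-triangle : ∀ {a c d x A} → Supports X A x → c ∉ A → d ∉ A → c ≢ a → d ≢ a → c ≢ d →
                      _≈_ X (act X [ (a , d) ] x) (act X [ (c , d) ] (act X [ (a , c) ] x))
  act-swap-triangle {a} {c} {d} {x} {A} A-supp c∉A d∉A c≢a d≢a c≢d =
    ≈.trans (act-cong [ (a , d) ] (≈.sym (A-supp [ (c , d) ] (swap-fixes A c∉A d∉A))))
    (≈.trans (≈.sym (act-comp [ (a , d) ] [ (c , d) ] x))
    (≈.trans (act-ext ((a , d) ∷ (c , d) ∷ []) ((c , d) ∷ (a , c) ∷ [])
               (λ z → sym (swap-triangle (≢-sym c≢a) (≢-sym d≢a) c≢d z)) x)
             (act-comp [ (c , d) ] [ (a , c) ] x)))

  act-swap-conj : ∀ π a d x →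
                  _≈_ X (act X [ (apply π a , apply π d) ] (act X π x)) (act X π (act X [ (a , d) ] x))
  act-swap-conj π a d x =
    ≈.trans (≈.sym (act-comp [ (apply π a , apply π d) ] π x))
    (≈.trans (act-ext ([ (apply π a , apply π d) ] ++ π) (π ++ [ (a , d) ])
               (λ z → trans (swap-conj (apply π) (apply-inj π) a d z) (sym (apply-++ π [ (a , d) ] z))) x)
             (act-comp π [ (a , d) ] x))

  absEq-names : ∀ {p q} → AbsEq X p q → List 𝔸
  absEq-names (c , _ , _ , (A , _ , _) , (B , _ , _) , _) = c ∷ A ++ B

  absEq-rename : ∀ {a x b y} (p : AbsEq X (a , x) (b , y)) d → d ∉ absEq-names p → d ≢ a → d ≢ b →
                 _≈_ X (act X [ (a , d) ] x) (act X [ (b , d) ] y)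
  absEq-rename (c , c≢a , c≢b , (A , A-supp , c∉A) , (B , B-supp , c∉B) , ac·x≈bc·y) d d∉ d≢a d≢b =
    ≈.trans (act-swap-triangle A-supp c∉A (∉-++ˡ A (∉-tail d∉)) c≢a d≢a (≢-sym (∉-head d∉)))
    (≈.trans (act-cong [ (c , d) ] ac·x≈bc·y)
             (≈.sym (act-swap-triangle B-supp c∉B (∉-++ʳ A (∉-tail d∉)) c≢b d≢b (≢-sym (∉-head d∉)))))

langNom : IsNominal Lang
langNom = record
  { ≈-equiv  = record { refl = λ w → refl ; sym = λ p w → sym (p w) ; trans = λ p q w → trans (p w) (q w) }
  ; act-cong = λ π p w → p (actW (inv π) w)
  ; act-id   = λ S w → cong (proj₁ S) (actW-id w)
  ; act-comp = λ π σ S w →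
      cong (proj₁ S) (sym (actW-pt (inv σ) (inv π) (inv (π ++ σ)) (λ d → sym (inv-++ π σ d)) w))
  ; act-ext  = λ π σ π≗σ S w →
      cong (proj₁ S) (actW-pointwise (inv π) (inv σ) (inv-pointwise π σ π≗σ) w)
  ; fin-supp = λ S → proj₂ (proj₂ S)
  }

module LangNominal = NominalSet Lang langNom

support : BarLang → List 𝔸
support S = proj₁ (proj₂ (proj₂ S))

support-supports : ∀ (S : BarLang) → SuppLang (support S) (proj₁ S)
support-supports S = proj₂ (proj₂ (proj₂ S))

∋-respects-α : ∀ (S : BarLang) → RespectsAlpha (proj₁ S)
∋-respects-α S = proj₁ (proj₂ S)

freshFor : BarLang → 𝔸
freshFor S = fresh (support S)

derivative : BarLetter → BarLang → BarLang
derivative l S =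
  (λ w → S ∋ (l ∷ w)) ,
  (λ v w v=αw → ∋-respects-α S (l ∷ v) (l ∷ w) (=α-cons l v=αw)) ,
  nameB l ∷ support S ,
  λ π fix w → trans (cong (λ l′ → S ∋ (l′ ∷ actW (inv π) w)) (sym (actB-fixed l π fix)))
                    (support-supports S π (λ z z∈ → fix z (there z∈)) (l ∷ w))
  where
  actB-fixed : ∀ l π → Fixes π (nameB l ∷ support S) → actB (inv π) l ≡ l
  actB-fixed (nm a)  π fix = cong nm (fixes-inv π _ fix a (here refl))
  actB-fixed (bar a) π fix = cong bar (fixes-inv π _ fix a (here refl))

supported-bar-rename : ∀ (f : BarString → Bool) A → SuppLang A f → ∀ {a c} → a ∉ A → c ∉ A →
                       ∀ w → f (bar a ∷ actW [ (a , c) ] w) ≡ f (bar c ∷ w)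
supported-bar-rename f A A-supp {a} {c} a∉A c∉A w =
  trans (sym (A-supp [ (a , c) ] (swap-fixes A a∉A c∉A) (bar a ∷ actW [ (a , c) ] w)))
        (cong₂ (λ z u → f (bar z ∷ u)) (swap-fst a c) (actW-swap-invol a c w))

Lang-absEq-intro : ∀ (S T : BarLang) a b K →
                   (∀ c → c ∉ K → c ≢ a → c ≢ b → c ∉ support S → c ∉ support T →
                      ∀ w → (S ∋ actW [ (a , c) ] w) ≡ (T ∋ actW [ (b , c) ] w)) →
                   AbsEq Lang (a , S) (b , T)
Lang-absEq-intro S T a b K ac·S≡bc·T =
  c , c≢a , c≢b , (support S , support-supports S , c∉S) , (support T , support-supports T , c∉T) ,
  ac·S≡bc·T c c∉K c≢a c≢b c∉S c∉T
  where
  L = a ∷ b ∷ support S ++ support T ++ K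
  c = fresh L
  c∉L = fresh-∉ L
  c≢a = ∉-head c∉L
  c≢b = ∉-head (∉-tail c∉L)
  c∉S = ∉-++ˡ (support S) (∉-tail (∉-tail c∉L))
  c∉T = ∉-++ˡ (support T) (∉-++ʳ (support S) (∉-tail (∉-tail c∉L)))
  c∉K = ∉-++ʳ (support T) (∉-++ʳ (support S) (∉-tail (∉-tail c∉L)))

τ : BarLang → GCar Lang
τ S = ⟨ S ∋ [] , (λ a → derivative (nm a) S) , (freshFor S , derivative (bar (freshFor S)) S) ⟩

τ-abstraction : ∀ (S : BarLang) {c} → c ∉ support S → ∀ w →
                (proj₂ (ab (τ S)) ∋ actW [ (freshFor S , c) ] w) ≡ (S ∋ (bar c ∷ w))
τ-abstraction S = supported-bar-rename (proj₁ S) (support S) (support-supports S) (fresh-∉ (support S))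

τ-isTau : IsTau τ
τ-isTau S = refl , (λ a w → refl) , abstraction
  where
  abstraction : ∀ a → Fresh Lang a S → ∀ T → (∀ w → (T ∋ w) ≡ (S ∋ (bar a ∷ w))) →
                AbsEq Lang (ab (τ S)) (a , T)
  abstraction a (B , B-supp , a∉B) T T≡S|a =
    Lang-absEq-intro (derivative (bar (freshFor S)) S) T (freshFor S) a B λ c c∉B _ _ c∉ _ w →
      trans (τ-abstraction S (∉-tail c∉) w)
            (sym (trans (T≡S|a _) (supported-bar-rename (proj₁ S) B B-supp a∉B c∉B w)))

τ-cong : ∀ {S T} → _≈_ Lang S T → _≈_ (G Lang) (τ S) (τ T)
τ-cong {S} {T} S≈T = S≈T [] , (λ a w → S≈T (nm a ∷ w)) ,
  Lang-absEq-intro (derivative (bar (freshFor S)) S) (derivative (bar (freshFor T)) T)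
                   (freshFor S) (freshFor T) [] λ c _ _ _ c∉ c∉′ w →
    trans (τ-abstraction S (∉-tail c∉) w)
          (trans (S≈T (bar c ∷ w)) (sym (τ-abstraction T (∉-tail c∉′) w)))

τ-equivariant : ∀ π S → _≈_ (G Lang) (τ (act Lang π S)) (act (G Lang) π (τ S))
τ-equivariant π S = refl , (λ a w → refl) ,
  Lang-absEq-intro (derivative (bar (freshFor πS)) πS) (act Lang π (derivative (bar (freshFor S)) S))
                   (freshFor πS) (apply π (freshFor S)) (support πS) λ c c∉ _ _ _ _ w →
    trans (τ-abstraction πS c∉ w)
          (sym (trans (cong (λ z → S ∋ (bar z ∷ actW (inv π) (actW [ (apply π (freshFor S) , c) ] w)))
                            (sym (inv-apply π (freshFor S))))
                      (supported-bar-rename (proj₁ πS) (support πS) (support-supports πS)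
                         (apply-∉-map π (support S) (fresh-∉ (support S))) c∉ w)))
  where
  πS = act Lang π S

module Unfold (𝕏 : Nom) (c : Carrier (Nom.raw 𝕏) → GCar (Nom.raw 𝕏))
              (c-equivariant : Equivariant (Nom.raw 𝕏) (G (Nom.raw 𝕏)) c) where
  X = Nom.raw 𝕏
  open IsNominal (Nom.isNom 𝕏)
  open NominalSet X (Nom.isNom 𝕏)

  c-cong : ∀ {x y} → _≈_ X x y → _≈_ (G X) (c x) (c y)
  c-cong = proj₁ c-equivariant

  c-act : ∀ π x → _≈_ (G X) (c (act X π x)) (act (G X) π (c x))
  c-act = proj₂ c-equivariant

  binder : Carrier X → 𝔸
  binder x = proj₁ (ab (c x))

  body : Carrier X → Carrier X
  body x = proj₂ (ab (c x))

  abs-cong : ∀ {x y} → _≈_ X x y → AbsEq X (binder x , body x) (binder y , body y)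
  abs-cong x≈y = proj₂ (proj₂ (c-cong x≈y))

  abs-act : ∀ π x → AbsEq X (binder (act X π x) , body (act X π x)) (apply π (binder x) , act X π (body x))
  abs-act π x = proj₂ (proj₂ (c-act π x))

  supp : Carrier X → List 𝔸
  supp x = proj₁ (fin-supp x)

  supp-supports : ∀ x → Supports X (supp x) x
  supp-supports x = proj₂ (fin-supp x)

  barAvoid : Carrier X → 𝔸 → BarString → List 𝔸
  barAvoid x a w = a ∷ binder x ∷ supp (body x) ++ names w

  -- The fuel n is the length of the word.
  accepts : ℕ → Carrier X → BarString → Bool
  accepts n       x []          = out (c x)
  accepts zero    x (_ ∷ _)     = false
  accepts (suc n) x (nm a ∷ w)  = accepts n (tr (c x) a) w
  accepts (suc n) x (bar a ∷ w) =
    accepts n (act X [ (binder x , fresh (barAvoid x a w)) ] (body x))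
              (actW [ (a , fresh (barAvoid x a w)) ] w)

  bodyAvoid : ∀ {x x′} π → _≈_ X x′ (act X π x) → List 𝔸
  bodyAvoid {x} {x′} π x′≈πx =
    binder x′ ∷ binder (act X π x) ∷ apply π (binder x) ∷
    absEq-names (abs-cong x′≈πx) ++ absEq-names (abs-act π x)

  body-equivariant : ∀ {x x′} π (x′≈πx : _≈_ X x′ (act X π x)) d → apply π d ∉ bodyAvoid π x′≈πx →
                     _≈_ X (act X [ (binder x′ , apply π d) ] (body x′))
                           (act X π (act X [ (binder x , d) ] (body x)))
  body-equivariant {x} {x′} π x′≈πx d πd∉ =
    ≈.trans (absEq-rename (abs-cong x′≈πx) (apply π d) (∉-++ˡ (absEq-names (abs-cong x′≈πx)) πd∉names)
               (∉-head πd∉) (∉-head (∉-tail πd∉)))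
    (≈.trans (absEq-rename (abs-act π x) (apply π d) (∉-++ʳ (absEq-names (abs-cong x′≈πx)) πd∉names)
               (∉-head (∉-tail πd∉)) (∉-head (∉-tail (∉-tail πd∉))))
             (act-swap-conj π (binder x) d (body x)))
    where
    πd∉names = ∉-tail (∉-tail (∉-tail πd∉))

  mutual
    accepts-bar : ∀ n w → length w ≡ n → ∀ x a d → d ∉ barAvoid x a w →
                  accepts (suc n) x (bar a ∷ w) ≡
                  accepts n (act X [ (binder x , d) ] (body x)) (actW [ (a , d) ] w)
    accepts-bar n w ∣w∣≡n x a d d∉ with d ≟ fresh (barAvoid x a w)
    ... | yes refl = refl
    ... | no d≢e =
      begin
        accepts n (act X [ (b , e) ] y) (actW [ (a , e) ] w)
      ≡⟨ sym (accepts-equivariant n (actW [ (a , e) ] w) (trans (length-actW _ w) ∣w∣≡n)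
                                  [ (e , d) ] bd·y≈ed·be·y) ⟩
        accepts n (act X [ (b , d) ] y) (actW [ (e , d) ] (actW [ (a , e) ] w))
      ≡⟨ cong (accepts n (act X [ (b , d) ] y))
              (actW-swap-triangle w (≢-sym (∉-head e∉)) (≢-sym (∉-head d∉)) (≢-sym d≢e) e∉w d∉w) ⟩
        accepts n (act X [ (b , d) ] y) (actW [ (a , d) ] w)
      ∎
      where
      open ≡-Reasoning
      b = binder x
      y = body x
      e = fresh (barAvoid x a w)
      e∉ = fresh-∉ (barAvoid x a w)
      e∉w = ∉-++ʳ (supp y) (∉-tail (∉-tail e∉))
      d∉w = ∉-++ʳ (supp y) (∉-tail (∉-tail d∉))
      bd·y≈ed·be·y : _≈_ X (act X [ (b , d) ] y) (act X [ (e , d) ] (act X [ (b , e) ] y))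
      bd·y≈ed·be·y = act-swap-triangle (supp-supports y)
                       (∉-++ˡ (supp y) (∉-tail (∉-tail e∉))) (∉-++ˡ (supp y) (∉-tail (∉-tail d∉)))
                       (∉-head (∉-tail e∉)) (∉-head (∉-tail d∉)) (≢-sym d≢e)

    accepts-equivariant : ∀ n w → length w ≡ n → ∀ {x x′} π → _≈_ X x′ (act X π x) →
                          accepts n x′ (actW π w) ≡ accepts n x w
    accepts-equivariant n [] _ {x} π x′≈πx = trans (proj₁ (c-cong x′≈πx)) (proj₁ (c-act π x))
    accepts-equivariant zero (_ ∷ _) ()
    accepts-equivariant (suc n) (nm a ∷ w) ∣w∣≡n {x} π x′≈πx =
      accepts-equivariant n w (suc-injective ∣w∣≡n) π
        (≈.trans (proj₁ (proj₂ (c-cong x′≈πx)) (apply π a))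
        (≈.trans (proj₁ (proj₂ (c-act π x)) (apply π a))
                 (≡⇒≈ (cong (λ z → act X π (tr (c x) z)) (inv-apply π a)))))
    accepts-equivariant (suc n) (bar a ∷ w) ∣w∣≡n {x} {x′} π x′≈πx =
      begin
        accepts (suc n) x′ (bar (apply π a) ∷ actW π w)
      ≡⟨ accepts-bar n (actW π w) (trans (length-actW π w) ∣w∣≡n′) x′ (apply π a) (apply π d)
                     (∉-++ˡ (barAvoid x′ (apply π a) (actW π w)) πd∉) ⟩
        accepts n (act X [ (binder x′ , apply π d) ] (body x′)) (actW [ (apply π a , apply π d) ] (actW π w))
      ≡⟨ cong (accepts n _) (actW-swap-conj π a d w) ⟩
        accepts n (act X [ (binder x′ , apply π d) ] (body x′)) (actW π (actW [ (a , d) ] w))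
      ≡⟨ accepts-equivariant n (actW [ (a , d) ] w) (trans (length-actW _ w) ∣w∣≡n′) π
           (body-equivariant π x′≈πx d (∉-++ʳ (barAvoid x′ (apply π a) (actW π w)) πd∉)) ⟩
        accepts n (act X [ (binder x , d) ] (body x)) (actW [ (a , d) ] w)
      ≡⟨ sym (accepts-bar n w ∣w∣≡n′ x a d (∉-++ˡ (barAvoid x a w) d∉)) ⟩
        accepts (suc n) x (bar a ∷ w)
      ∎
      where
      open ≡-Reasoning
      ∣w∣≡n′ = suc-injective ∣w∣≡n
      L′ = barAvoid x′ (apply π a) (actW π w) ++ bodyAvoid π x′≈πx
      d = fresh (barAvoid x a w ++ map (apply (inv π)) L′)
      d∉ = fresh-∉ (barAvoid x a w ++ map (apply (inv π)) L′)
      πd∉ = ∉-map-inv⇒apply-∉ π L′ (∉-++ʳ (barAvoid x a w) d∉)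

  accept : Carrier X → BarString → Bool
  accept x w = accepts (length w) x w

  accept-equivariant : ∀ {x x′} π → _≈_ X x′ (act X π x) → ∀ w → accept x′ (actW π w) ≡ accept x w
  accept-equivariant π x′≈πx w =
    trans (cong (λ k → accepts k _ (actW π w)) (length-actW π w))
          (accepts-equivariant (length w) w refl π x′≈πx)

  accept-bar : ∀ x a d w → d ∉ barAvoid x a w →
               accept x (bar a ∷ w) ≡ accept (act X [ (binder x , d) ] (body x)) (actW [ (a , d) ] w)
  accept-bar x a d w d∉ =
    trans (accepts-bar (length w) w refl x a d d∉)
          (cong (λ k → accepts k _ (actW [ (a , d) ] w)) (sym (length-actW [ (a , d) ] w)))

  -- The permutation σ accumulates the renamings performed while reading the prefix u.
  accept-α-abs : ∀ u {a b v w e} → e ≢ a → e ≢ b → e ∉ names v → e ∉ names w →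
                 actW [ (a , e) ] v ≡ actW [ (b , e) ] w →
                 ∀ σ x → accept x (actW σ (u ++ bar a ∷ v)) ≡ accept x (actW σ (u ++ bar b ∷ w))
  accept-α-abs [] {a} {b} {v} {w} {e} e≢a e≢b e∉v e∉w ae·v≡be·w σ x =
    begin
      accept x (bar (apply σ a) ∷ actW σ v)
    ≡⟨ accept-bar x (apply σ a) (apply σ d) (actW σ v) (∉-++ˡ Lv σd∉) ⟩
      accept x′ (actW [ (apply σ a , apply σ d) ] (actW σ v))
    ≡⟨ cong (accept x′) (actW-swap-conj σ a d v) ⟩
      accept x′ (actW σ (actW [ (a , d) ] v))
    ≡⟨ cong (λ u → accept x′ (actW σ u)) ad·v≡bd·w ⟩
      accept x′ (actW σ (actW [ (b , d) ] w))
    ≡⟨ cong (accept x′) (sym (actW-swap-conj σ b d w)) ⟩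
      accept x′ (actW [ (apply σ b , apply σ d) ] (actW σ w))
    ≡⟨ sym (accept-bar x (apply σ b) (apply σ d) (actW σ w) (∉-++ʳ Lv σd∉)) ⟩
      accept x (bar (apply σ b) ∷ actW σ w)
    ∎
    where
    open ≡-Reasoning
    Lv = barAvoid x (apply σ a) (actW σ v)
    Lw = barAvoid x (apply σ b) (actW σ w)
    K = a ∷ b ∷ e ∷ names v ++ names w
    d = fresh (K ++ map (apply (inv σ)) (Lv ++ Lw))
    d∉ = fresh-∉ (K ++ map (apply (inv σ)) (Lv ++ Lw))
    d∉K = ∉-++ˡ K d∉
    σd∉ = ∉-map-inv⇒apply-∉ σ (Lv ++ Lw) (∉-++ʳ K d∉)
    x′ = act X [ (binder x , apply σ d) ] (body x)
    ad·v≡bd·w = actW-abs-rename e≢a e≢b e∉v e∉w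
                  (∉-head d∉K) (∉-head (∉-tail d∉K)) (∉-head (∉-tail (∉-tail d∉K)))
                  (∉-++ˡ (names v) d∉vw) (∉-++ʳ (names v) d∉vw) ae·v≡be·w
      where
      d∉vw = ∉-tail (∉-tail (∉-tail d∉K))
  accept-α-abs (nm a′ ∷ u) e≢a e≢b e∉v e∉w ae·v≡be·w σ x =
    accept-α-abs u e≢a e≢b e∉v e∉w ae·v≡be·w σ (tr (c x) (apply σ a′))
  accept-α-abs (bar a′ ∷ u) {a} {b} {v} {w} e≢a e≢b e∉v e∉w ae·v≡be·w σ x =
    begin
      accept x (bar (apply σ a′) ∷ actW σ U)
    ≡⟨ accept-bar x (apply σ a′) d (actW σ U) (∉-++ˡ P d∉) ⟩
      accept x′ (actW [ (apply σ a′ , d) ] (actW σ U))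
    ≡⟨ cong (accept x′) (actW-∷ (apply σ a′ , d) σ U) ⟩
      accept x′ (actW ((apply σ a′ , d) ∷ σ) U)
    ≡⟨ accept-α-abs u e≢a e≢b e∉v e∉w ae·v≡be·w ((apply σ a′ , d) ∷ σ) x′ ⟩
      accept x′ (actW ((apply σ a′ , d) ∷ σ) U′)
    ≡⟨ cong (accept x′) (sym (actW-∷ (apply σ a′ , d) σ U′)) ⟩
      accept x′ (actW [ (apply σ a′ , d) ] (actW σ U′))
    ≡⟨ sym (accept-bar x (apply σ a′) d (actW σ U′) (∉-++ʳ P d∉)) ⟩
      accept x (bar (apply σ a′) ∷ actW σ U′)
    ∎
    where
    open ≡-Reasoning
    U = u ++ bar a ∷ v
    U′ = u ++ bar b ∷ w
    P = barAvoid x (apply σ a′) (actW σ U)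
    P′ = barAvoid x (apply σ a′) (actW σ U′)
    d = fresh (P ++ P′)
    d∉ = fresh-∉ (P ++ P′)
    x′ = act X [ (binder x , d) ] (body x)

  accept-α : ∀ {v w} → v =α w → ∀ x → accept x v ≡ accept x w
  accept-α α-refl x = refl
  accept-α (α-sym v=αw) x = sym (accept-α v=αw x)
  accept-α (α-trans u=αv v=αw) x = trans (accept-α u=αv x) (accept-α v=αw x)
  accept-α (α-abs u a b v w e e≢a e≢b e∉v e∉w ae·v≡be·w) x =
    trans (cong (accept x) (sym (actW-id (u ++ bar a ∷ v))))
    (trans (accept-α-abs u e≢a e≢b e∉v e∉w ae·v≡be·w [] x)
           (cong (accept x) (actW-id (u ++ bar b ∷ w))))

  accept-supported : ∀ x → SuppLang (supp x) (accept x)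
  accept-supported x π fix = accept-equivariant (inv π) (≈.sym (supp-supports x (inv π) (fixes-inv π _ fix)))

  unfold : Carrier X → BarLang
  unfold x = accept x , (λ v w v=αw → accept-α v=αw x) , supp x , accept-supported x

  unfold-equivariant : Equivariant X Lang unfold
  unfold-equivariant =
    (λ {x} {y} x≈y w → trans (cong (accept x) (sym (actW-id w)))
                             (accept-equivariant [] (≈.trans x≈y (≈.sym (act-id y))) w)) ,
    (λ π x w → trans (cong (accept (act X π x)) (sym (actW-inv π w)))
                     (accept-equivariant π ≈.refl (actW (inv π) w)))

  unfold-commutes : ∀ x → _≈_ (G Lang) (τ (unfold x)) (Gmap X Lang unfold (c x))
  unfold-commutes x = refl , (λ a w → refl) ,
    Lang-absEq-intro (derivative (bar a₀) (unfold x)) (unfold y) a₀ b []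
      λ c′ _ _ c′≢b c′∉ c′∉y → abstraction c′ c′≢b (∉-tail c′∉) c′∉y
    where
    a₀ = freshFor (unfold x)
    b = binder x
    y = body x
    abstraction : ∀ c′ → c′ ≢ b → c′ ∉ supp x → c′ ∉ supp y →
                  ∀ w → accept x (bar a₀ ∷ actW [ (a₀ , c′) ] w) ≡ accept y (actW [ (b , c′) ] w)
    abstraction c′ c′≢b c′∉x c′∉y w =
      begin
        accept x (bar a₀ ∷ actW [ (a₀ , c′) ] w)
      ≡⟨ τ-abstraction (unfold x) c′∉x w ⟩
        accept x (bar c′ ∷ w)
      ≡⟨ accept-bar x c′ d w d∉ ⟩
        accept (act X [ (b , d) ] y) (actW [ (c′ , d) ] w)
      ≡⟨ cong (accept (act X [ (b , d) ] y)) (sym π·bc′·w≡c′d·w) ⟩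
        accept (act X [ (b , d) ] y) (actW π (actW [ (b , c′) ] w))
      ≡⟨ accept-equivariant π bd·y≈π·y (actW [ (b , c′) ] w) ⟩
        accept y (actW [ (b , c′) ] w)
      ∎
      where
      open ≡-Reasoning
      d = fresh (barAvoid x c′ w)
      d∉ = fresh-∉ (barAvoid x c′ w)
      π = (c′ , d) ∷ (b , c′) ∷ []
      π·bc′·w≡c′d·w : actW π (actW [ (b , c′) ] w) ≡ actW [ (c′ , d) ] w
      π·bc′·w≡c′d·w =
        actW-pt π [ (b , c′) ] [ (c′ , d) ] (λ z → cong (swap c′ d) (swap-invol b c′ z)) w
      bd·y≈π·y : _≈_ X (act X [ (b , d) ] y) (act X π y)
      bd·y≈π·y = ≈.trans (act-swap-triangle (supp-supports y) c′∉y (∉-++ˡ (supp y) (∉-tail (∉-tail d∉)))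
                                              c′≢b (∉-head (∉-tail d∉)) (≢-sym (∉-head d∉)))
                         (≈.sym (act-comp [ (c′ , d) ] [ (b , c′) ] y))

  unfold-isCoalgHom : IsCoalgHom X c τ unfold
  unfold-isCoalgHom = unfold-equivariant , unfold-commutes

  module _ (h : Carrier X → BarLang) (h-hom : IsCoalgHom X c τ h) where
    h-abs : ∀ x → AbsEq Lang (ab (τ (h x))) (binder x , h (body x))
    h-abs x = proj₂ (proj₂ (proj₂ h-hom x))

    h-abs-names : Carrier X → List 𝔸
    h-abs-names x = LangNominal.absEq-names {ab (τ (h x))} {binder x , h (body x)} (h-abs x)

    homAvoid : Carrier X → List 𝔸
    homAvoid x = freshFor (h x) ∷ binder x ∷ h-abs-names x ++ support (h x)

    hom-bar : ∀ x d → d ∉ homAvoid x →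
              ∀ w → (h x ∋ (bar d ∷ w)) ≡ (h (body x) ∋ actW [ (binder x , d) ] w)
    hom-bar x d d∉ w =
      trans (sym (τ-abstraction (h x) (∉-++ʳ (h-abs-names x) (∉-tail (∉-tail d∉))) w))
            (LangNominal.absEq-rename {a₀} {derivative (bar a₀) (h x)} {binder x} {h (body x)}
               (h-abs x) d (∉-++ˡ (h-abs-names x) (∉-tail (∉-tail d∉))) (∉-head d∉) (∉-head (∉-tail d∉)) w)
      where
      a₀ = freshFor (h x)

  hom-unique-on : ∀ h₁ h₂ → IsCoalgHom X c τ h₁ → IsCoalgHom X c τ h₂ →
                  ∀ n w → length w ≡ n → ∀ x → (h₁ x ∋ w) ≡ (h₂ x ∋ w)
  hom-unique-on h₁ h₂ H₁ H₂ n [] _ x = trans (proj₁ (proj₂ H₁ x)) (sym (proj₁ (proj₂ H₂ x)))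
  hom-unique-on h₁ h₂ H₁ H₂ zero (_ ∷ _) ()
  hom-unique-on h₁ h₂ H₁ H₂ (suc n) (nm a ∷ w) ∣w∣≡n x =
    trans (proj₁ (proj₂ (proj₂ H₁ x)) a w)
    (trans (hom-unique-on h₁ h₂ H₁ H₂ n w (suc-injective ∣w∣≡n) (tr (c x) a))
           (sym (proj₁ (proj₂ (proj₂ H₂ x)) a w)))
  hom-unique-on h₁ h₂ H₁ H₂ (suc n) (bar a ∷ w) ∣w∣≡n x =
    begin
      h₁ x ∋ (bar a ∷ w)
    ≡⟨ ∋-respects-α (h₁ x) _ _ bar-renamed ⟩
      h₁ x ∋ (bar d ∷ actW [ (a , d) ] w)
    ≡⟨ hom-bar h₁ H₁ x d (∉-++ˡ (homAvoid h₁ H₁ x) d∉homs) (actW [ (a , d) ] w) ⟩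
      h₁ (body x) ∋ w′
    ≡⟨ hom-unique-on h₁ h₂ H₁ H₂ n w′ ∣w′∣≡n (body x) ⟩
      h₂ (body x) ∋ w′
    ≡⟨ sym (hom-bar h₂ H₂ x d (∉-++ʳ (homAvoid h₁ H₁ x) d∉homs) (actW [ (a , d) ] w)) ⟩
      h₂ x ∋ (bar d ∷ actW [ (a , d) ] w)
    ≡⟨ sym (∋-respects-α (h₂ x) _ _ bar-renamed) ⟩
      h₂ x ∋ (bar a ∷ w)
    ∎
    where
    open ≡-Reasoning
    L = a ∷ names w ++ homAvoid h₁ H₁ x ++ homAvoid h₂ H₂ x
    d = fresh L
    d∉ = fresh-∉ L
    d∉homs = ∉-++ʳ (names w) (∉-tail d∉)
    bar-renamed = bar-rename-α a d w (∉-head d∉) (∉-++ˡ (names w) (∉-tail d∉))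
    w′ = actW [ (binder x , d) ] (actW [ (a , d) ] w)
    ∣w′∣≡n = trans (length-actW _ (actW [ (a , d) ] w)) (trans (length-actW _ w) (suc-injective ∣w∣≡n))

  hom-unique : ∀ h₁ h₂ → IsCoalgHom X c τ h₁ → IsCoalgHom X c τ h₂ →
               ∀ x → _≈_ Lang (h₁ x) (h₂ x)
  hom-unique h₁ h₂ H₁ H₂ x w = hom-unique-on h₁ h₂ H₁ H₂ (length w) w refl x

mainTheorem13 :
    IsNominal Lang ×
    Σ (BarLang → GCar Lang) (λ τ →
      IsTau τ ×
      Equivariant Lang (G Lang) τ ×
      ((X : Nom) → (c : Carrier (Nom.raw X) → GCar (Nom.raw X)) →
        Equivariant (Nom.raw X) (G (Nom.raw X)) c →
        Σ (Carrier (Nom.raw X) → BarLang) (λ h → IsCoalgHom (Nom.raw X) c τ h) ×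
        ((h₁ h₂ : Carrier (Nom.raw X) → BarLang) →
          IsCoalgHom (Nom.raw X) c τ h₁ → IsCoalgHom (Nom.raw X) c τ h₂ →
          ∀ x → _≈_ Lang (h₁ x) (h₂ x))))
mainTheorem13 = langNom , τ , τ-isTau , ((λ {S} {T} → τ-cong {S} {T}) , τ-equivariant) ,
  λ X c c-equivariant → let open Unfold X c c-equivariant in (unfold , unfold-isCoalgHom) , hom-unique
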